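{- Let $m\geqslant 1$ be an integer. Define $g\colon \mathfrak S_{2m+1}\to\mathfrak S_{2m+2}$ by $g(u)=\rho(\alpha u^{ -1}\beta^{ -1})$, where, in one-line notation, $\alpha=(1\,3\,5\,\ldots\,2m\!+\!1\;2\,4\,\ldots\,2m)\in\mathfrak S_{2m+1}$ and $\beta=(2\,4\,\ldots\,2m\;2m\!+\!1\;1\,3\,\ldots\,2m\!-\!1)\in\mathfrak S_{2m+1}$, and $\rho\colon\mathfrak S_{2m+1}\to\mathfrak S_{2m+2}$ is given by $\rho(v)=(v(1)\,v(2)\,\ldots\,v(2m)\;2m\!+\!2\;v(2m\!+\!1))$. Then for every $u\in\mathfrak S_{2m+1}$, $$u\in[\mathrm{id},w_{2m+1}]\iff g(u)\in B_{2m+2}.$$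
   Context: $\mathfrak S_n$ is the group of permutations of $\{1,\ldots,n\}$; a permutation $\pi$ is written in one-line notation $(\pi(1)\,\pi(2)\,\ldots\,\pi(n))$, and products are compositions of functions: $(\alpha u^{ -1}\beta^{ -1})(x)=\alpha(u^{ -1}(\beta^{ -1}(x)))$. The distance on $\mathfrak S_n$ is $D(u,v)=\sum_{i=1}^n|u(i)-v(i)|$, and the segment is $[\mathrm{id},u]=\{v\in\mathfrak S_n: D(\mathrm{id},v)+D(v,u)=D(\mathrm{id},u)\}$ (equivalently, $v\in[\mathrm{id},u]$ iff $\min(i,u(i))\leqslant v(i)\leqslant\max(i,u(i))$ for all $i$). For $n=2m+1$, $w_{2m+1}=(m\!+\!1\;m\!+\!2\;\ldots\;2m\!+\!1\;1\;2\;\ldots\;m)$, i.e. $w_{2m+1}(p)=m+p$ for $p\leqslant m+1$ and $w_{2m+1}(p)=p-m-1$ for $p\geqslant m+2$. For $n\geqslant1$, $B_{2n}$ is the set of permutations $\pi\in\mathfrak S_{2n}$ such that $\pi(2i)\leqslant 2i\leqslant\pi(2i-1)$ for all $i=1,\ldots,n$. -}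

module Defs where

open import Data.Nat using (ℕ; zero; suc; _+_; _*_; _∸_; _≤_; _≡ᵇ_; ∣_-_∣)
open import Data.Nat.ListAction using (sum)
open import Data.List using (List; []; _∷_; _++_; map; upTo; [_])
open import Data.Bool using (if_then_else_)
open import Data.Fin using (Fin; toℕ; fromℕ<)
open import Data.Fin.Permutation using (Permutation′; _⟨$⟩ʳ_; _⟨$⟩ˡ_)
open import Data.Nat.Properties using (_<?_)
open import Relation.Nullary using (yes; no)
open import Data.Product using (_×_)

-- Conventions: a permutation of {1,…,n} is handled through its
-- value function ℕ → ℕ on positions 1,…,n (1-based, as in the paper);
-- values at positions outside {1,…,n} are irrelevant (set to 0).

range : ℕ → List ℕ
range n = map suc (upTo n)

at : List ℕ → ℕ → ℕ
at []       _             = 0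
at (x ∷ xs) zero          = 0
at (x ∷ xs) (suc zero)    = x
at (x ∷ xs) (suc (suc p)) = at xs (suc p)

-- 1-based position of the first occurrence of x in a one-line word
-- (this is the inverse permutation when the word is a permutation)
posOf : ℕ → List ℕ → ℕ
posOf x []       = 0
posOf x (y ∷ ys) = if x ≡ᵇ y then 1 else suc (posOf x ys)

app : ∀ {n} → Permutation′ n → ℕ → ℕ
app {n} u zero    = 0
app {n} u (suc k) with k <? n
... | yes k<n = suc (toℕ (u ⟨$⟩ʳ fromℕ< k<n))
... | no  _   = 0

appInv : ∀ {n} → Permutation′ n → ℕ → ℕ
appInv {n} u zero    = 0
appInv {n} u (suc k) with k <? n
... | yes k<n = suc (toℕ (u ⟨$⟩ˡ fromℕ< k<n))
... | no  _   = 0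

idf : ℕ → ℕ
idf p = p

D : ℕ → (ℕ → ℕ) → (ℕ → ℕ) → ℕ
D n u v = sum (map (λ i → ∣ u i - v i ∣) (range n))

InSegment : ℕ → (v u : ℕ → ℕ) → Set
InSegment n v u = D n idf v + D n v u ≡ D n idf u
  where open import Relation.Binary.PropositionalEquality using (_≡_)

w : ℕ → ℕ → ℕ
w m p with m <? p ∸ 1
... | yes _ = p ∸ m ∸ 1
... | no  _ = m + p

alphaWord : ℕ → List ℕ
alphaWord m = map (λ k → 2 * k + 1) (upTo (suc m)) ++ map (λ k → 2 * k + 2) (upTo m)

betaWord : ℕ → List ℕ
betaWord m = map (λ k → 2 * k + 2) (upTo m) ++ [ 2 * m + 1 ] ++ map (λ k → 2 * k + 1) (upTo m)

rho : ℕ → (ℕ → ℕ) → List ℕ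
rho m v = map v (range (2 * m)) ++ (2 * m + 2) ∷ v (2 * m + 1) ∷ []

g : (m : ℕ) → Permutation′ (2 * m + 1) → List ℕ
g m u = rho m (λ x → at (alphaWord m) (appInv u (posOf x (betaWord m))))

InB : ℕ → List ℕ → Set
InB n π = ∀ i → 1 ≤ i → i ≤ n → (at π (2 * i) ≤ 2 * i) × (2 * i ≤ at π (2 * i ∸ 1))

-- By the triangle inequality termwise, D(id,u) + D(u,w) = D(id,w) holds iff it holds in every term,
-- i.e. iff every value u(p) lies between p and w(p); reindexing by j = u(p), iff every j lies between
-- P = u⁻¹(j) and w(P). That interval is [P, P + m] with α(P) = 2P − 1 when P ≤ m + 1, and [q, P]
-- with α(P) = 2q when P = m + 1 + q. In both cases, for i ≤ m, the condition at j = i says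
-- α(P) ≤ 2i and the condition at j = m + 1 + i says 2i ≤ α(P), while j = m + 1 is unconstrained.
-- As β⁻¹ maps 2i ↦ i, 2i − 1 ↦ m + 1 + i and 2m + 1 ↦ m + 1, these are exactly the inequalities
-- g(u)(2i) ≤ 2i ≤ g(u)(2i − 1) defining B_{2m+2}; the two for i = m + 1 hold automatically.

module Submission where

open import Defs
open import Data.Nat using (ℕ; _+_; _*_; _≤_)
open import Data.Fin.Permutation using (Permutation′)
open import Function.Bundles using (_⇔_)

open import Data.Bool using (true; false; T; if_then_else_)
open import Data.Unit using (tt)
open import Data.Fin using (toℕ; fromℕ<)
open import Data.Fin.Permutation using (flip; _⟨$⟩ʳ_; _⟨$⟩ˡ_; inverseʳ)
open import Data.Fin.Properties using (toℕ<n; fromℕ<-toℕ; toℕ-fromℕ<)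
open import Data.List using (List; []; _∷_; _++_; map; length; upTo; applyUpTo)
open import Data.List.Properties using (length-map; length-upTo; map-upTo; map-∘)
open import Data.List.Membership.Propositional using (_∈_; _∉_)
open import Data.List.Membership.Propositional.Properties using (∈-map⁺; ∈-map⁻; ∈-upTo⁺)
open import Data.List.Relation.Unary.All using (All; []; _∷_)
open import Data.List.Relation.Unary.Any using (here; there)
open import Data.List.Relation.Unary.All.Properties using (map⁺; map⁻; applyUpTo⁺₁; applyUpTo⁻)
open import Data.Nat using (zero; suc; _<_; _∸_; _≡ᵇ_; ∣_-_∣; z≤n; s≤s; s≤s⁻¹; z<s)
open import Data.Nat.ListAction using (sum)
open import Data.Nat.Properties
open import Algebra.Properties.CommutativeSemigroup +-commutativeSemigroup using (interchange)
open import Data.Product using (_×_; _,_; proj₁; proj₂)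
open import Data.Sum using (inj₁; inj₂)
open import Function using (_∘_; id)
open import Function.Bundles using (mk⇔; Equivalence)
open import Function.Definitions using (Injective)
open import Function.Related.Propositional using (module EquationalReasoning)
open import Relation.Binary.PropositionalEquality
open import Relation.Nullary using (yes; no; contradiction)

open Equivalence using (to; from)

OnSegment : ℕ → ℕ → ℕ → Set
OnSegment a b x = ∣ a - x ∣ + ∣ x - b ∣ ≡ ∣ a - b ∣

OnSegment-sym : ∀ {a b x} → OnSegment a b x → OnSegment b a x
OnSegment-sym {a} {b} {x} eq = begin
  ∣ b - x ∣ + ∣ x - a ∣ ≡⟨ +-comm ∣ b - x ∣ ∣ x - a ∣ ⟩
  ∣ x - a ∣ + ∣ b - x ∣ ≡⟨ cong₂ _+_ (∣-∣-comm x a) (∣-∣-comm b x) ⟩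
  ∣ a - x ∣ + ∣ x - b ∣ ≡⟨ eq ⟩
  ∣ a - b ∣             ≡⟨ ∣-∣-comm a b ⟩
  ∣ b - a ∣             ∎
  where open ≡-Reasoning

≤×≤⇒OnSegment : ∀ {a b x} → a ≤ x → x ≤ b → OnSegment a b x
≤×≤⇒OnSegment {x = x} z≤n x≤b = trans (cong (x +_) (m≤n⇒∣m-n∣≡n∸m x≤b)) (m+[n∸m]≡n x≤b)
≤×≤⇒OnSegment (s≤s a≤x) (s≤s x≤b) = ≤×≤⇒OnSegment a≤x x≤b

OnSegment⇒≤×≤ : ∀ {a b x} → a ≤ b → OnSegment a b x → a ≤ x × x ≤ b
OnSegment⇒≤×≤ {zero} {b} {x} _ eq = z≤n , subst (x ≤_) eq (m≤m+n x _)
OnSegment⇒≤×≤ {suc a} {b} {zero} a≤b eq = contradiction b≥suc-a+b (<⇒≱ (m<n+m b z<s))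
  where
  b≥suc-a+b : suc a + b ≤ b
  b≥suc-a+b = ≤-trans (≤-reflexive eq) (≤-trans (∣m-n∣≤m⊔n (suc a) b) (≤-reflexive (m≤n⇒m⊔n≡n a≤b)))
OnSegment⇒≤×≤ {suc a} {suc b} {suc x} (s≤s a≤b) eq with OnSegment⇒≤×≤ a≤b eq
... | a≤x , x≤b = s≤s a≤x , s≤s x≤b

OnSegment⇔≤×≤ : ∀ {a b x} → a ≤ b → OnSegment a b x ⇔ (a ≤ x × x ≤ b)
OnSegment⇔≤×≤ a≤b = mk⇔ (OnSegment⇒≤×≤ a≤b) (λ (a≤x , x≤b) → ≤×≤⇒OnSegment a≤x x≤b)

OnSegment⇔≥×≥ : ∀ {a b x} → b ≤ a → OnSegment a b x ⇔ (b ≤ x × x ≤ a)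
OnSegment⇔≥×≥ {a} {b} {x} b≤a =
  mk⇔ (to (OnSegment⇔≤×≤ b≤a) ∘ OnSegment-sym {a}) (OnSegment-sym {b} ∘ from (OnSegment⇔≤×≤ b≤a))

m≤n∧o≤p∧n+p≡m+o⇒n≡m×p≡o : ∀ {m n o p} → m ≤ n → o ≤ p → n + p ≡ m + o → n ≡ m × p ≡ o
m≤n∧o≤p∧n+p≡m+o⇒n≡m×p≡o {m} {n} {o} {p} m≤n o≤p eq =
  n≡m , +-cancelˡ-≡ n p o (trans eq (cong (_+ o) (sym n≡m)))
  where
  n≡m : n ≡ m
  n≡m = ≤-antisym (+-cancelʳ-≤ p n m (≤-trans (≤-reflexive eq) (+-monoʳ-≤ m o≤p))) m≤n

module _ {A : Set} (f g h : A → ℕ) (h≤f+g : ∀ x → h x ≤ f x + g x) where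

  sum-map≤sum-map+sum-map : ∀ xs → sum (map h xs) ≤ sum (map f xs) + sum (map g xs)
  sum-map≤sum-map+sum-map [] = z≤n
  sum-map≤sum-map+sum-map (x ∷ xs) = begin
    h x + sum (map h xs)                             ≤⟨ +-mono-≤ (h≤f+g x) (sum-map≤sum-map+sum-map xs) ⟩
    (f x + g x) + (sum (map f xs) + sum (map g xs)) ≡⟨ interchange (f x) (g x) _ _ ⟩
    (f x + sum (map f xs)) + (g x + sum (map g xs)) ∎
    where open ≤-Reasoning

  sum-map+sum-map≡sum-map⇔All : ∀ xs →
    (sum (map f xs) + sum (map g xs) ≡ sum (map h xs)) ⇔ All (λ x → f x + g x ≡ h x) xs
  sum-map+sum-map≡sum-map⇔All xs = mk⇔ (tight⇒All xs) (All⇒tight xs)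
    where
    tight⇒All : ∀ xs → sum (map f xs) + sum (map g xs) ≡ sum (map h xs) → All (λ x → f x + g x ≡ h x) xs
    tight⇒All [] _ = []
    tight⇒All (x ∷ xs) eq with m≤n∧o≤p∧n+p≡m+o⇒n≡m×p≡o (h≤f+g x) (sum-map≤sum-map+sum-map xs)
                                 (trans (interchange (f x) (g x) _ _) eq)
    ... | head , tail = head ∷ tight⇒All xs tail

    All⇒tight : ∀ xs → All (λ x → f x + g x ≡ h x) xs → sum (map f xs) + sum (map g xs) ≡ sum (map h xs)
    All⇒tight [] [] = refl
    All⇒tight (x ∷ xs) (head ∷ tail) =
      trans (interchange (f x) _ (g x) _) (cong₂ _+_ head (All⇒tight xs tail))

All-range⇔ : ∀ {P : ℕ → Set} n → All P (range n) ⇔ (∀ {k} → k < n → P (suc k))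
All-range⇔ {P} n = mk⇔ All⇒∀ ∀⇒All
  where
  All⇒∀ : All P (range n) → ∀ {k} → k < n → P (suc k)
  All⇒∀ all = applyUpTo⁻ id n (map⁻ all)

  ∀⇒All : (∀ {k} → k < n → P (suc k)) → All P (range n)
  ∀⇒All all = map⁺ (applyUpTo⁺₁ id n all)

InSegment⇔OnSegment : ∀ n (v u : ℕ → ℕ) →
  InSegment n v u ⇔ (∀ {k} → k < n → OnSegment (suc k) (u (suc k)) (v (suc k)))
InSegment⇔OnSegment n v u = begin
  InSegment n v u
    ∼⟨ sum-map+sum-map≡sum-map⇔All (λ i → ∣ i - v i ∣) (λ i → ∣ v i - u i ∣) (λ i → ∣ i - u i ∣)
         (λ i → ∣-∣-triangle i (v i) (u i)) (range n) ⟩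
  All (λ i → OnSegment i (u i) (v i)) (range n)
    ∼⟨ All-range⇔ n ⟩
  (∀ {k} → k < n → OnSegment (suc k) (u (suc k)) (v (suc k))) ∎
  where open EquationalReasoning

module _ {n : ℕ} (u : Permutation′ n) where

  app-suc : ∀ {k} (k<n : k < n) → app u (suc k) ≡ suc (toℕ (u ⟨$⟩ʳ fromℕ< k<n))
  app-suc {k} k<n with k <? n
  ... | yes _   = refl
  ... | no  k≮n = contradiction k<n k≮n

  appInv≡app-flip : ∀ x → appInv u x ≡ app (flip u) x
  appInv≡app-flip zero = refl
  appInv≡app-flip (suc k) with k <? n
  ... | yes _ = refl
  ... | no  _ = refl

  app≡appInv-flip : ∀ x → app u x ≡ appInv (flip u) x
  app≡appInv-flip zero = refl
  app≡appInv-flip (suc k) with k <? n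
  ... | yes _ = refl
  ... | no  _ = refl

appInv-suc : ∀ {n} (u : Permutation′ n) {k} (k<n : k < n) → appInv u (suc k) ≡ suc (toℕ (u ⟨$⟩ˡ fromℕ< k<n))
appInv-suc u {k} k<n = trans (appInv≡app-flip u (suc k)) (app-suc (flip u) k<n)

∀app⇒∀appInv : ∀ {n} (u : Permutation′ n) (R : ℕ → ℕ → Set) →
  (∀ {k} → k < n → R (suc k) (app u (suc k))) → ∀ {k} → k < n → R (appInv u (suc k)) (suc k)
∀app⇒∀appInv u R H {k} k<n = subst₂ R (sym (appInv-suc u k<n)) app-suc-i (H (toℕ<n i))
  where
  j = fromℕ< k<n
  i = u ⟨$⟩ˡ j

  app-suc-i : app u (suc (toℕ i)) ≡ suc k
  app-suc-i = begin
    app u (suc (toℕ i))                   ≡⟨ app-suc u (toℕ<n i) ⟩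
    suc (toℕ (u ⟨$⟩ʳ fromℕ< (toℕ<n i))) ≡⟨ cong (λ i′ → suc (toℕ (u ⟨$⟩ʳ i′))) (fromℕ<-toℕ i (toℕ<n i)) ⟩
    suc (toℕ (u ⟨$⟩ʳ i))                 ≡⟨ cong (suc ∘ toℕ) (inverseʳ u) ⟩
    suc (toℕ j)                           ≡⟨ cong suc (toℕ-fromℕ< k<n) ⟩
    suc k                                 ∎
    where open ≡-Reasoning

∀app⇔∀appInv : ∀ {n} (u : Permutation′ n) (R : ℕ → ℕ → Set) →
  (∀ {k} → k < n → R (suc k) (app u (suc k))) ⇔ (∀ {k} → k < n → R (appInv u (suc k)) (suc k))
∀app⇔∀appInv {n} u R = mk⇔ (∀app⇒∀appInv u R) ∀appInv⇒∀app
  where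
  ∀appInv⇒∀app : (∀ {k} → k < n → R (appInv u (suc k)) (suc k)) → ∀ {k} → k < n → R (suc k) (app u (suc k))
  ∀appInv⇒∀app H {k} k<n =
    subst (R (suc k)) (sym (app≡appInv-flip u (suc k)))
      (∀app⇒∀appInv (flip u) (λ a b → R b a) H′ k<n)
    where
    H′ : ∀ {k} → k < n → R (app (flip u) (suc k)) (suc k)
    H′ {k′} k′<n = subst (λ a → R a (suc k′)) (appInv≡app-flip u (suc k′)) (H k′<n)

at-applyUpTo : ∀ (f : ℕ → ℕ) {n k} → k < n → at (applyUpTo f n) (suc k) ≡ f k
at-applyUpTo f {suc n} {zero}  _         = refl
at-applyUpTo f {suc n} {suc k} (s≤s k<n) = at-applyUpTo (f ∘ suc) k<n

at-map-upTo : ∀ (f : ℕ → ℕ) {n k} → k < n → at (map f (upTo n)) (suc k) ≡ f k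
at-map-upTo f {n} {k} k<n = trans (cong (λ xs → at xs (suc k)) (map-upTo f n)) (at-applyUpTo f k<n)

at-++ˡ : ∀ xs {ys k} → k < length xs → at (xs ++ ys) (suc k) ≡ at xs (suc k)
at-++ˡ (x ∷ xs) {k = zero}  _         = refl
at-++ˡ (x ∷ xs) {k = suc k} (s≤s k<n) = at-++ˡ xs k<n

at-++ʳ : ∀ xs {ys k} → at (xs ++ ys) (length xs + suc k) ≡ at ys (suc k)
at-++ʳ []       = refl
at-++ʳ (x ∷ xs) {ys} {k} rewrite +-suc (length xs) k =
  trans (cong (at (xs ++ ys)) (sym (+-suc (length xs) k))) (at-++ʳ xs)

length-map-upTo : ∀ (f : ℕ → ℕ) n → length (map f (upTo n)) ≡ n
length-map-upTo f n = trans (length-map f (upTo n)) (length-upTo n)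

posOf-head : ∀ x ys → posOf x (x ∷ ys) ≡ 1
posOf-head x ys with x ≡ᵇ x | ≡⇒≡ᵇ x x refl
... | true | _ = refl

posOf-tail : ∀ x y ys → x ≢ y → posOf x (y ∷ ys) ≡ suc (posOf x ys)
posOf-tail x y ys x≢y with x ≡ᵇ y in eq
... | false = refl
... | true  = contradiction (≡ᵇ⇒≡ x y (subst T (sym eq) tt)) x≢y

posOf-map : ∀ {f : ℕ → ℕ} → Injective _≡_ _≡_ f → ∀ x xs → posOf (f x) (map f xs) ≡ posOf x xs
posOf-map f-inj x [] = refl
posOf-map {f} f-inj x (y ∷ ys) with x ≟ y
... | yes refl = trans (posOf-head (f x) (map f ys)) (sym (posOf-head x ys))
... | no  x≢y  = begin
  posOf (f x) (f y ∷ map f ys) ≡⟨ posOf-tail (f x) (f y) (map f ys) (x≢y ∘ f-inj) ⟩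
  suc (posOf (f x) (map f ys)) ≡⟨ cong suc (posOf-map f-inj x ys) ⟩
  suc (posOf x ys)             ≡⟨ posOf-tail x y ys x≢y ⟨
  posOf x (y ∷ ys)             ∎
  where open ≡-Reasoning

posOf-upTo : ∀ {n k} → k < n → posOf k (upTo n) ≡ suc k
posOf-upTo {suc n} {zero}  _         = posOf-head 0 (applyUpTo suc n)
posOf-upTo {suc n} {suc k} (s≤s k<n) = begin
  posOf (suc k) (0 ∷ applyUpTo suc n)   ≡⟨ posOf-tail (suc k) 0 (applyUpTo suc n) (λ ()) ⟩
  suc (posOf (suc k) (applyUpTo suc n)) ≡⟨ cong (suc ∘ posOf (suc k)) (sym (map-upTo suc n)) ⟩
  suc (posOf (suc k) (map suc (upTo n))) ≡⟨ cong suc (posOf-map suc-injective k (upTo n)) ⟩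
  suc (posOf k (upTo n))                ≡⟨ cong suc (posOf-upTo k<n) ⟩
  suc (suc k)                           ∎
  where open ≡-Reasoning

posOf-++-∈ : ∀ {x} xs {ys} → x ∈ xs → posOf x (xs ++ ys) ≡ posOf x xs
posOf-++-∈ {x} (y ∷ xs) {ys} (here refl) = trans (posOf-head x (xs ++ ys)) (sym (posOf-head x xs))
posOf-++-∈ {x} (y ∷ xs) (there x∈xs) = cong (λ p → if x ≡ᵇ y then 1 else suc p) (posOf-++-∈ xs x∈xs)

posOf-++-∉ : ∀ {x} xs {ys} → x ∉ xs → posOf x (xs ++ ys) ≡ length xs + posOf x ys
posOf-++-∉ []       _    = refl
posOf-++-∉ {x} (y ∷ xs) {ys} x∉xs =
  trans (posOf-tail x y (xs ++ ys) (x∉xs ∘ here)) (cong suc (posOf-++-∉ xs (x∉xs ∘ there)))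

2*n+1≡1+2*n : ∀ n → 2 * n + 1 ≡ suc (2 * n)
2*n+1≡1+2*n n = +-comm (2 * n) 1

2*n+2≡2*[1+n] : ∀ n → 2 * n + 2 ≡ 2 * suc n
2*n+2≡2*[1+n] n = trans (+-comm (2 * n) 2) (sym (*-suc 2 n))

2*[1+n]∸1≡1+2*n : ∀ n → 2 * suc n ∸ 1 ≡ suc (2 * n)
2*[1+n]∸1≡1+2*n n = +-suc n (n + 0)

2*n+c-injective : ∀ c → Injective _≡_ _≡_ (λ k → 2 * k + c)
2*n+c-injective c {a} {b} eq = *-cancelˡ-≡ a b 2 (+-cancelʳ-≡ c (2 * a) (2 * b) eq)

2*m+1≢2*n+2 : ∀ m n → 2 * m + 1 ≢ 2 * n + 2
2*m+1≢2*n+2 m n eq = even≢odd (suc n) m (trans (sym (2*n+2≡2*[1+n] n)) (trans (sym eq) (2*n+1≡1+2*n m)))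

m<n⇔2*m<2*n : ∀ {m n} → m < n ⇔ 2 * m < 2 * n
m<n⇔2*m<2*n = mk⇔ (*-monoʳ-< 2) (*-cancelˡ-< 2 _ _)

m≤n⇔2*m≤2*n : ∀ {m n} → m ≤ n ⇔ 2 * m ≤ 2 * n
m≤n⇔2*m≤2*n = mk⇔ (*-monoʳ-≤ 2) (*-cancelˡ-≤ 2)

m≤n⇔2*m≤1+2*n : ∀ {m n} → m ≤ n ⇔ 2 * m ≤ suc (2 * n)
m≤n⇔2*m≤1+2*n {m} {n} = mk⇔ (m≤n⇒m≤1+n ∘ *-monoʳ-≤ 2) 2*m≤1+2*n⇒m≤n
  where
  2*m≤1+2*n⇒m≤n : 2 * m ≤ suc (2 * n) → m ≤ n
  2*m≤1+2*n⇒m≤n le = s≤s⁻¹ (*-cancelˡ-< 2 m (suc n) (≤-trans (s≤s le) (≤-reflexive (sym (*-suc 2 n)))))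

m+n≤m+o⇔n≤o : ∀ m {n o} → m + n ≤ m + o ⇔ n ≤ o
m+n≤m+o⇔n≤o m = mk⇔ (+-cancelˡ-≤ m _ _) (+-monoʳ-≤ m)

2*n+1≡1+n+n : ∀ n → 2 * n + 1 ≡ suc (n + n)
2*n+1≡1+n+n n = trans (2*n+1≡1+2*n n) (cong (λ k → suc (n + k)) (+-identityʳ n))

-- The positions that w moves up by m, and those it moves down by m + 1.
data Half (m : ℕ) : ℕ → Set where
  lower : ∀ {q} → q ≤ m → Half m (suc q)
  upper : ∀ {q} → q < m → Half m (suc (m + suc q))

half : ∀ {m k} → k < 2 * m + 1 → Half m (suc k)
half {m} {k} k<2m+1 with k ≤? m
... | yes k≤m = lower k≤m
... | no  k≰m = subst (Half m ∘ suc) m+1+q≡k (upper q<m)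
  where
  q = k ∸ suc m

  m+1+q≡k : m + suc q ≡ k
  m+1+q≡k = trans (+-suc m q) (m+[n∸m]≡n (≰⇒> k≰m))

  q<m : q < m
  q<m = +-cancelˡ-≤ m (suc q) m (s≤s⁻¹ (subst₂ _<_ (sym m+1+q≡k) (2*n+1≡1+n+n m) k<2m+1))

Half⇒< : ∀ {m k} → Half m (suc k) → k < 2 * m + 1
Half⇒< {m} (lower {q} q≤m) = subst (q <_) (sym (2*n+1≡1+n+n m)) (s≤s (≤-trans q≤m (m≤m+n m m)))
Half⇒< {m} (upper {q} q<m) = subst (m + suc q <_) (sym (2*n+1≡1+n+n m)) (s≤s (+-monoʳ-≤ m q<m))

w-lower : ∀ {m q} → q ≤ m → w m (suc q) ≡ m + suc q
w-lower {m} {q} q≤m with m <? q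
... | yes m<q = contradiction q≤m (<⇒≱ m<q)
... | no  _   = refl

w-upper : ∀ m q → w m (suc (m + suc q)) ≡ suc q
w-upper m q with m <? m + suc q
... | yes _   = cong (_∸ 1) (trans (cong (_∸ m) (sym (+-suc m (suc q)))) (m+n∸m≡n m (suc (suc q))))
... | no  m≮ = contradiction (m<m+n m z<s) m≮

OnSegment-lower : ∀ {m q j} → q ≤ m → OnSegment (suc q) (w m (suc q)) j ⇔ (suc q ≤ j × j ≤ m + suc q)
OnSegment-lower {m} {q} q≤m rewrite w-lower q≤m = OnSegment⇔≤×≤ (m≤n+m (suc q) m)

OnSegment-upper : ∀ {m q j} →
  OnSegment (suc (m + suc q)) (w m (suc (m + suc q))) j ⇔ (suc q ≤ j × j ≤ suc (m + suc q))
OnSegment-upper {m} {q} rewrite w-upper m q = OnSegment⇔≥×≥ (m≤n⇒m≤1+n (m≤n+m (suc q) m))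

alpha : ℕ → ℕ → ℕ
alpha m = at (alphaWord m)

betaInv : ℕ → ℕ → ℕ
betaInv m x = posOf x (betaWord m)

module _ (m : ℕ) where
  private
    odds : ℕ → List ℕ
    odds n = map (λ k → 2 * k + 1) (upTo n)

    evens : List ℕ
    evens = map (λ k → 2 * k + 2) (upTo m)

  alpha-lower : ∀ {q} → q ≤ m → alpha m (suc q) ≡ suc (2 * q)
  alpha-lower {q} q≤m = begin
    at (odds (suc m) ++ evens) (suc q)
      ≡⟨ at-++ˡ (odds (suc m)) (subst (q <_) (sym (length-map-upTo _ (suc m))) (s≤s q≤m)) ⟩
    at (odds (suc m)) (suc q)          ≡⟨ at-map-upTo _ (s≤s q≤m) ⟩
    2 * q + 1                          ≡⟨ 2*n+1≡1+2*n q ⟩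
    suc (2 * q)                        ∎
    where open ≡-Reasoning

  alpha-upper : ∀ {q} → q < m → alpha m (suc (m + suc q)) ≡ 2 * suc q
  alpha-upper {q} q<m = begin
    at (odds (suc m) ++ evens) (suc m + suc q)
      ≡⟨ cong (λ l → at (odds (suc m) ++ evens) (l + suc q)) (sym (length-map-upTo _ (suc m))) ⟩
    at (odds (suc m) ++ evens) (length (odds (suc m)) + suc q) ≡⟨ at-++ʳ (odds (suc m)) ⟩
    at evens (suc q)                                           ≡⟨ at-map-upTo _ q<m ⟩
    2 * q + 2                                                  ≡⟨ 2*n+2≡2*[1+n] q ⟩
    2 * suc q                                                  ∎
    where open ≡-Reasoning

  odd∉evens : ∀ q → 2 * q + 1 ∉ evens
  odd∉evens q odd∈evens with ∈-map⁻ (λ k → 2 * k + 2) odd∈evens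
  ... | k , _ , eq = 2*m+1≢2*n+2 q k eq

  betaInv-even : ∀ {q} → q < m → betaInv m (2 * suc q) ≡ suc q
  betaInv-even {q} q<m = begin
    posOf (2 * suc q) (evens ++ _)
      ≡⟨ posOf-++-∈ evens (subst (_∈ evens) (2*n+2≡2*[1+n] q) (∈-map⁺ (λ k → 2 * k + 2) (∈-upTo⁺ q<m))) ⟩
    posOf (2 * suc q) evens        ≡⟨ cong (λ x → posOf x evens) (sym (2*n+2≡2*[1+n] q)) ⟩
    posOf (2 * q + 2) evens        ≡⟨ posOf-map (2*n+c-injective 2) q (upTo m) ⟩
    posOf q (upTo m)               ≡⟨ posOf-upTo q<m ⟩
    suc q                          ∎
    where open ≡-Reasoning

  betaInv-odd : ∀ {q} → q < m → betaInv m (2 * q + 1) ≡ suc (m + suc q)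
  betaInv-odd {q} q<m = begin
    posOf (2 * q + 1) (evens ++ (2 * m + 1) ∷ odds m)    ≡⟨ posOf-++-∉ evens (odd∉evens q) ⟩
    length evens + posOf (2 * q + 1) ((2 * m + 1) ∷ odds m)
      ≡⟨ cong₂ _+_ (length-map-upTo _ m) (posOf-tail _ _ (odds m) (<⇒≢ q<m ∘ 2*n+c-injective 1)) ⟩
    m + suc (posOf (2 * q + 1) (odds m))
      ≡⟨ cong (λ p → m + suc p) (posOf-map (2*n+c-injective 1) q (upTo m)) ⟩
    m + suc (posOf q (upTo m))                           ≡⟨ cong (λ p → m + suc p) (posOf-upTo q<m) ⟩
    m + suc (suc q)                                      ≡⟨ +-suc m (suc q) ⟩
    suc (m + suc q)                                      ∎
    where open ≡-Reasoning

  betaInv-middle : betaInv m (2 * m + 1) ≡ suc m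
  betaInv-middle = begin
    posOf (2 * m + 1) (evens ++ (2 * m + 1) ∷ odds m)    ≡⟨ posOf-++-∉ evens (odd∉evens m) ⟩
    length evens + posOf (2 * m + 1) ((2 * m + 1) ∷ odds m)
      ≡⟨ cong₂ _+_ (length-map-upTo _ m) (posOf-head (2 * m + 1) (odds m)) ⟩
    m + 1                                                ≡⟨ +-comm m 1 ⟩
    suc m                                                ∎
    where open ≡-Reasoning

  module _ (v : ℕ → ℕ) where
    private
      init : List ℕ
      init = map v (range (2 * m))

      length-init : length init ≡ 2 * m
      length-init = trans (length-map v (range (2 * m))) (length-map-upTo suc (2 * m))

    rho-init : ∀ {k} → k < 2 * m → at (rho m v) (suc k) ≡ v (suc k)
    rho-init {k} k<2m = begin
      at (init ++ _) (suc k)               ≡⟨ at-++ˡ init (subst (k <_) (sym length-init) k<2m) ⟩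
      at init (suc k)                      ≡⟨ cong (λ xs → at xs (suc k)) (sym (map-∘ (upTo (2 * m)))) ⟩
      at (map (v ∘ suc) (upTo (2 * m))) (suc k) ≡⟨ at-map-upTo (v ∘ suc) k<2m ⟩
      v (suc k)                            ∎
      where open ≡-Reasoning

    rho-penultimate : at (rho m v) (2 * m + 1) ≡ 2 * m + 2
    rho-penultimate = trans (cong (λ l → at (rho m v) (l + 1)) (sym length-init)) (at-++ʳ init)

    rho-last : at (rho m v) (2 * m + 2) ≡ v (2 * m + 1)
    rho-last = trans (cong (λ l → at (rho m v) (l + 2)) (sym length-init)) (at-++ʳ init)

OnSegment⇔alpha≤ : ∀ {m p i} → Half m p → i ≤ suc m → OnSegment p (w m p) i ⇔ alpha m p ≤ 2 * i
OnSegment⇔alpha≤ {m} {_} {i} (lower {q} q≤m) i≤1+m = begin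
  OnSegment (suc q) (w m (suc q)) i ∼⟨ OnSegment-lower q≤m ⟩
  (suc q ≤ i × i ≤ m + suc q)
    ∼⟨ mk⇔ proj₁ (_, ≤-trans i≤1+m (≤-trans (s≤s (m≤m+n m q)) (≤-reflexive (sym (+-suc m q))))) ⟩
  q < i                             ∼⟨ m<n⇔2*m<2*n ⟩
  suc (2 * q) ≤ 2 * i               ≡⟨ cong (_≤ 2 * i) (sym (alpha-lower m q≤m)) ⟩
  alpha m (suc q) ≤ 2 * i           ∎
  where open EquationalReasoning
OnSegment⇔alpha≤ {m} {_} {i} (upper {q} q<m) i≤1+m = begin
  OnSegment (suc (m + suc q)) (w m (suc (m + suc q))) i ∼⟨ OnSegment-upper ⟩
  (suc q ≤ i × i ≤ suc (m + suc q))                     ∼⟨ mk⇔ proj₁ (_, ≤-trans i≤1+m (s≤s (m≤m+n m (suc q)))) ⟩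
  suc q ≤ i                                             ∼⟨ m≤n⇔2*m≤2*n ⟩
  2 * suc q ≤ 2 * i                                     ≡⟨ cong (_≤ 2 * i) (sym (alpha-upper m q<m)) ⟩
  alpha m (suc (m + suc q)) ≤ 2 * i                     ∎
  where open EquationalReasoning

OnSegment⇔≤alpha : ∀ {m p i} → Half m p → i ≤ m → OnSegment p (w m p) (suc (m + i)) ⇔ 2 * i ≤ alpha m p
OnSegment⇔≤alpha {m} {_} {i} (lower {q} q≤m) i≤m = begin
  OnSegment (suc q) (w m (suc q)) (suc (m + i)) ∼⟨ OnSegment-lower q≤m ⟩
  (suc q ≤ suc (m + i) × suc (m + i) ≤ m + suc q) ∼⟨ mk⇔ proj₂ (s≤s (≤-trans q≤m (m≤m+n m i)) ,_) ⟩
  suc (m + i) ≤ m + suc q                       ≡⟨ cong (_≤ m + suc q) (sym (+-suc m i)) ⟩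
  m + suc i ≤ m + suc q                         ∼⟨ m+n≤m+o⇔n≤o m ⟩
  i < suc q                                     ∼⟨ mk⇔ s≤s⁻¹ s≤s ⟩
  i ≤ q                                         ∼⟨ m≤n⇔2*m≤1+2*n ⟩
  2 * i ≤ suc (2 * q)                           ≡⟨ cong (2 * i ≤_) (sym (alpha-lower m q≤m)) ⟩
  2 * i ≤ alpha m (suc q)                       ∎
  where open EquationalReasoning
OnSegment⇔≤alpha {m} {_} {i} (upper {q} q<m) i≤m = begin
  OnSegment (suc (m + suc q)) (w m (suc (m + suc q))) (suc (m + i)) ∼⟨ OnSegment-upper ⟩
  (suc q ≤ suc (m + i) × suc (m + i) ≤ suc (m + suc q))             ∼⟨ mk⇔ proj₂ (s≤s (≤-trans (<⇒≤ q<m) (m≤m+n m i)) ,_) ⟩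
  suc (m + i) ≤ suc (m + suc q)                                     ∼⟨ mk⇔ s≤s⁻¹ s≤s ⟩
  m + i ≤ m + suc q                                                 ∼⟨ m+n≤m+o⇔n≤o m ⟩
  i ≤ suc q                                                         ∼⟨ m≤n⇔2*m≤2*n ⟩
  2 * i ≤ 2 * suc q                                                 ≡⟨ cong (2 * i ≤_) (sym (alpha-upper m q<m)) ⟩
  2 * i ≤ alpha m (suc (m + suc q))                                 ∎
  where open EquationalReasoning

module _ (m : ℕ) (u : Permutation′ (2 * m + 1)) where
  private
    P : ℕ → ℕ
    P = appInv u

    V : ℕ → ℕ
    V x = alpha m (P (betaInv m x))

    ≤⇒1+≤m+1 : ∀ {q} → q ≤ m → suc q ≤ m + 1
    ≤⇒1+≤m+1 {q} q≤m = subst (suc q ≤_) (+-comm 1 m) (s≤s q≤m)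

  SegmentAt : ℕ → Set
  SegmentAt j = OnSegment (P j) (w m (P j)) j

  half-appInv : ∀ {k} → k < 2 * m + 1 → Half m (P (suc k))
  half-appInv k<n = subst (Half m) (sym (appInv-suc u k<n)) (half (toℕ<n _))

  g-even : ∀ {q} → q ≤ m → at (g m u) (2 * suc q) ≡ alpha m (P (suc q))
  g-even {q} q≤m with m≤n⇒m<n∨m≡n q≤m
  ... | inj₁ q<m = trans (rho-init m V (*-monoʳ-≤ 2 q<m)) (cong (alpha m ∘ P) (betaInv-even m q<m))
  ... | inj₂ refl = begin
    at (g m u) (2 * suc m) ≡⟨ cong (at (g m u)) (sym (2*n+2≡2*[1+n] m)) ⟩
    at (g m u) (2 * m + 2) ≡⟨ rho-last m V ⟩
    V (2 * m + 1)          ≡⟨ cong (alpha m ∘ P) (betaInv-middle m) ⟩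
    alpha m (P (suc m))    ∎
    where open ≡-Reasoning

  g-odd : ∀ {q} → q < m → at (g m u) (2 * suc q ∸ 1) ≡ alpha m (P (suc (m + suc q)))
  g-odd {q} q<m = begin
    at (g m u) (2 * suc q ∸ 1)     ≡⟨ cong (at (g m u)) (2*[1+n]∸1≡1+2*n q) ⟩
    at (g m u) (suc (2 * q))       ≡⟨ rho-init m V (*-monoʳ-< 2 q<m) ⟩
    V (suc (2 * q))                ≡⟨ cong V (sym (2*n+1≡1+2*n q)) ⟩
    V (2 * q + 1)                  ≡⟨ cong (alpha m ∘ P) (betaInv-odd m q<m) ⟩
    alpha m (P (suc (m + suc q)))  ∎
    where open ≡-Reasoning

  g-penultimate : at (g m u) (2 * suc m ∸ 1) ≡ 2 * suc m
  g-penultimate = begin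
    at (g m u) (2 * suc m ∸ 1) ≡⟨ cong (at (g m u)) (trans (2*[1+n]∸1≡1+2*n m) (sym (2*n+1≡1+2*n m))) ⟩
    at (g m u) (2 * m + 1)     ≡⟨ rho-penultimate m V ⟩
    2 * m + 2                  ≡⟨ 2*n+2≡2*[1+n] m ⟩
    2 * suc m                  ∎
    where open ≡-Reasoning

  Segments⇒InB : (∀ {k} → k < 2 * m + 1 → SegmentAt (suc k)) → InB (m + 1) (g m u)
  Segments⇒InB S (suc q) _ 1+q≤m+1 = even-condition , odd-condition
    where
    q≤m : q ≤ m
    q≤m = s≤s⁻¹ (subst (suc q ≤_) (+-comm m 1) 1+q≤m+1)

    even-condition : at (g m u) (2 * suc q) ≤ 2 * suc q
    even-condition = subst (_≤ 2 * suc q) (sym (g-even q≤m))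
      (to (OnSegment⇔alpha≤ (half-appInv q<n) (s≤s q≤m)) (S q<n))
      where q<n = Half⇒< (lower q≤m)

    odd-condition : 2 * suc q ≤ at (g m u) (2 * suc q ∸ 1)
    odd-condition with m≤n⇒m<n∨m≡n q≤m
    ... | inj₁ q<m = subst (2 * suc q ≤_) (sym (g-odd q<m))
      (to (OnSegment⇔≤alpha (half-appInv m+1+q<n) q<m) (S m+1+q<n))
      where m+1+q<n = Half⇒< (upper q<m)
    ... | inj₂ refl = ≤-reflexive (sym g-penultimate)

  InB⇒Segments : InB (m + 1) (g m u) → ∀ {k} → k < 2 * m + 1 → SegmentAt (suc k)
  InB⇒Segments B k<n with half k<n
  ... | lower {q} q≤m = from (OnSegment⇔alpha≤ (half-appInv k<n) (s≤s q≤m))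
    (subst (_≤ 2 * suc q) (g-even q≤m) (proj₁ (B (suc q) (s≤s z≤n) (≤⇒1+≤m+1 q≤m))))
  ... | upper {q} q<m = from (OnSegment⇔≤alpha (half-appInv k<n) q<m)
    (subst (2 * suc q ≤_) (g-odd q<m) (proj₂ (B (suc q) (s≤s z≤n) (≤⇒1+≤m+1 (<⇒≤ q<m)))))

mainTheorem1 : (m : ℕ) → 1 ≤ m → (u : Permutation′ (2 * m + 1)) →
    InSegment (2 * m + 1) (app u) (w m) ⇔ InB (m + 1) (g m u)
mainTheorem1 m _ u = begin
  InSegment (2 * m + 1) (app u) (w m)
    ∼⟨ InSegment⇔OnSegment (2 * m + 1) (app u) (w m) ⟩
  (∀ {k} → k < 2 * m + 1 → OnSegment (suc k) (w m (suc k)) (app u (suc k)))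
    ∼⟨ ∀app⇔∀appInv u (λ i j → OnSegment i (w m i) j) ⟩
  (∀ {k} → k < 2 * m + 1 → SegmentAt m u (suc k))
    ∼⟨ mk⇔ (Segments⇒InB m u) (InB⇒Segments m u) ⟩
  InB (m + 1) (g m u) ∎
  where open EquationalReasoning
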